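{- Let $\mathfrak{T}=(T;<)$ be a tree and $t,u\in T$. The following are equivalent: (1) there exists a bridge $B$ with $t,u\in B$; (2) $[t]=[u]$; (3) for every path $P$ in $\mathfrak{T}$, $t\in P$ if and only if $u\in P$; (4) for every node $v\in T$, $v$ is comparable with $t$ if and only if $v$ is comparable with $u$.
   Context: A forest is a strict partial order $(F;<)$ such that for every $x$ the set $\{y:y<x\}$ is linearly ordered; a tree is a forest that is downward-connected: for all $x,y$ there is $z$ with $z\leqslant x$ and $z\leqslant y$. Trees are not assumed well-founded or rooted. Nodes $t,u$ are comparable if $t<u$, $t=u$ or $u<t$. A path is a maximal linearly ordered set of nodes. A set $A$ is convex if $x<z<y$ with $x,y\in A$ implies $z\in A$; a segment is a convex linearly ordered set; a bridge is a nonempty segment $B$ such that for every path $P$, either $B\subseteq P$ or $B\cap P=\emptyset$. Every node $t$ lies in a unique maximal (under inclusion) bridge, denoted $[t]$. -}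

module Defs where

open import Level using (Level; suc; _⊔_)
open import Data.Product using (Σ; ∃; _×_; _,_)
open import Data.Sum using (_⊎_)
open import Data.Empty using (⊥)
open import Relation.Binary.Core using (Rel)
open import Relation.Binary.Structures using (IsStrictPartialOrder)
open import Relation.Binary.PropositionalEquality using (_≡_)
open import Relation.Unary using (Pred; _∈_; _⊆_)
open import Axiom.ExcludedMiddle using (ExcludedMiddle)

module _ {ℓ : Level} {A : Set ℓ} (_<_ : Rel A ℓ) where

  _≤_ : Rel A ℓ
  x ≤ y = (x < y) ⊎ (x ≡ y)

  Comparable : Rel A ℓ
  Comparable x y = (x < y) ⊎ ((x ≡ y) ⊎ (y < x))

  Linear : Pred A ℓ → Set ℓ
  Linear S = ∀ x y → x ∈ S → y ∈ S → Comparable x y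

  IsPath : Pred A ℓ → Set (suc ℓ)
  IsPath P = Linear P × (∀ (Q : Pred A ℓ) → Linear Q → P ⊆ Q → Q ⊆ P)

  Convex : Pred A ℓ → Set ℓ
  Convex S = ∀ x y z → x ∈ S → y ∈ S → x < z → z < y → z ∈ S

  Segment : Pred A ℓ → Set ℓ
  Segment S = Convex S × Linear S

  IsBridge : Pred A ℓ → Set (suc ℓ)
  IsBridge B = (∃ λ x → x ∈ B) × Segment B
             × (∀ (P : Pred A ℓ) → IsPath P → (B ⊆ P) ⊎ (∀ x → x ∈ B → x ∈ P → ⊥))

  IsMaximalBridge : Pred A ℓ → Set (suc ℓ)
  IsMaximalBridge B = IsBridge B × (∀ (B′ : Pred A ℓ) → IsBridge B′ → B ⊆ B′ → B′ ⊆ B)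

  -- M is [t], i.e. M is the (unique) maximal bridge containing t
  IsBridgeClassOf : A → Pred A ℓ → Set (suc ℓ)
  IsBridgeClassOf t M = IsMaximalBridge M × t ∈ M

-- A tree (T; <): strict partial order, every initial segment {y : y < x} is
-- linearly ordered, and downward-connected. Not assumed well-founded or rooted.
record Tree (ℓ : Level) : Set (suc ℓ) where
  field
    Carrier : Set ℓ
    _<_ : Rel Carrier ℓ
    isStrictPartialOrder : IsStrictPartialOrder _≡_ _<_
    predecessorsLinear : ∀ x y z → y < x → z < x → Comparable _<_ y z
    downwardConnected : ∀ x y → ∃ λ z → (_≤_ _<_ z x) × (_≤_ _<_ z y)

-- Classical ambient axioms (the paper works in ZFC):
-- Hausdorff maximal principle: every chain in a strict partial order extends to a maximal chain.
HausdorffMaximalPrinciple : (ℓ : Level) → Set (suc ℓ)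
HausdorffMaximalPrinciple ℓ =
  ∀ (A : Set ℓ) (_<_ : Rel A ℓ) → IsStrictPartialOrder _≡_ _<_ →
  ∀ (C : Pred A ℓ) → Linear _<_ C → ∃ λ P → IsPath _<_ P × (C ⊆ P)

{-# OPTIONS --safe #-}
module Submission where

-- Conditions (3) and (4) are equivalent because a path, being a maximal
-- chain, contains every node comparable with all of its members, and every
-- comparable pair of nodes lies on a common path (Hausdorff).  The class
-- C t = {u : u is comparable with exactly the nodes t is comparable with} is
-- then a bridge: it is linear because all its members lie on a path through t,
-- convex because paths in a forest are downward closed, and by excluded middle
-- every path either contains t, and hence all of C t, or misses C t entirely.
-- Every bridge through t lies inside C t, so C t is the maximal bridge [t],
-- which gives the remaining equivalences.

open import Defs
open import Level using (Level)
open import Data.Product using (∃; _×_; _,_; proj₁; proj₂)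
open import Data.Sum using (_⊎_; inj₁; inj₂)
open import Data.Empty using (⊥; ⊥-elim)
open import Function.Base using (_∘_)
open import Function.Bundles using (_⇔_; mk⇔; Equivalence)
open import Function.Construct.Identity using (⇔-id)
open import Function.Construct.Symmetry using (⇔-sym)
open import Function.Construct.Composition using (_⇔-∘_)
open import Relation.Unary using (Pred; _∈_; _⊆_; _≐_)
open import Relation.Unary.Properties using (≐-trans; ≐-sym)
open import Relation.Binary.Core using (Rel)
open import Relation.Binary.Definitions using (Reflexive; Symmetric)
open import Relation.Binary.PropositionalEquality using (_≡_; refl)
open import Relation.Binary.Structures using (IsStrictPartialOrder)
open import Relation.Nullary using (yes; no)
open import Axiom.ExcludedMiddle using (ExcludedMiddle)

open Equivalence using (to; from)

module _ {a : Level} {A : Set a} (_<_ : Rel A a) where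

  SamePaths : Rel A (Level.suc a)
  SamePaths t u = ∀ (P : Pred A a) → IsPath _<_ P → (t ∈ P ⇔ u ∈ P)

  SameComparables : Rel A a
  SameComparables t u = ∀ v → Comparable _<_ v t ⇔ Comparable _<_ v u

  InCommonBridge : Rel A (Level.suc a)
  InCommonBridge t u = ∃ λ (B : Pred A a) → IsBridge _<_ B × t ∈ B × u ∈ B

  SameBridgeClass : Rel A (Level.suc a)
  SameBridgeClass t u =
    ∀ (M N : Pred A a) → IsBridgeClassOf _<_ t M → IsBridgeClassOf _<_ u N → M ≐ N

module PathProperties {a : Level} {A : Set a} (_<_ : Rel A a) where

  comparable-refl : Reflexive (Comparable _<_)
  comparable-refl = inj₂ (inj₁ refl)

  comparable-sym : Symmetric (Comparable _<_)
  comparable-sym (inj₁ x<y)          = inj₂ (inj₂ x<y)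
  comparable-sym (inj₂ (inj₁ refl))  = comparable-refl
  comparable-sym (inj₂ (inj₂ y<x))   = inj₁ y<x

  comparableWithAll⇒∈path : ∀ {P : Pred A a} → IsPath _<_ P → ∀ x →
                            (∀ w → w ∈ P → Comparable _<_ x w) → x ∈ P
  comparableWithAll⇒∈path {P} (linearP , maximalP) x x~P =
    maximalP P∪x linearP∪x inj₁ (inj₂ refl)
    where
    P∪x : Pred A a
    P∪x y = y ∈ P ⊎ y ≡ x

    linearP∪x : Linear _<_ P∪x
    linearP∪x y z (inj₁ y∈P)  (inj₁ z∈P)  = linearP y z y∈P z∈P
    linearP∪x y z (inj₁ y∈P)  (inj₂ refl) = comparable-sym (x~P y y∈P)
    linearP∪x y z (inj₂ refl) (inj₁ z∈P)  = x~P z z∈P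
    linearP∪x y z (inj₂ refl) (inj₂ refl) = comparable-refl

  sameComparables⇒samePaths : ∀ {t u} → SameComparables _<_ t u → SamePaths _<_ t u
  sameComparables⇒samePaths {t} {u} t≈u P pathP = mk⇔
    (λ t∈P → comparableWithAll⇒∈path pathP u λ w w∈P →
               comparable-sym (to (t≈u w) (proj₁ pathP w t w∈P t∈P)))
    (λ u∈P → comparableWithAll⇒∈path pathP t λ w w∈P →
               comparable-sym (from (t≈u w) (proj₁ pathP w u w∈P u∈P)))

  bridge⇒samePaths : ∀ {B : Pred A a} → IsBridge _<_ B →
                     ∀ {t u} → t ∈ B → u ∈ B → SamePaths _<_ t u
  bridge⇒samePaths (_ , _ , allOrNothing) {t} {u} t∈B u∈B P pathP
    with allOrNothing P pathP
  ... | inj₁ B⊆P     = mk⇔ (λ _ → B⊆P u∈B) (λ _ → B⊆P t∈B)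
  ... | inj₂ B∩P≡∅   = mk⇔ (λ t∈P → ⊥-elim (B∩P≡∅ t t∈B t∈P))
                           (λ u∈P → ⊥-elim (B∩P≡∅ u u∈B u∈P))

  inCommonBridge⇒samePaths : ∀ {t u} → InCommonBridge _<_ t u → SamePaths _<_ t u
  inCommonBridge⇒samePaths (B , bridgeB , t∈B , u∈B) = bridge⇒samePaths bridgeB t∈B u∈B

  sameComparables-refl : Reflexive (SameComparables _<_)
  sameComparables-refl v = ⇔-id _

  sameComparables⇒≐ : ∀ {t u} → SameComparables _<_ t u →
                      SameComparables _<_ t ≐ SameComparables _<_ u
  sameComparables⇒≐ t≈u =
    (λ t≈x v → t≈x v ⇔-∘ ⇔-sym (t≈u v)) , (λ u≈x v → u≈x v ⇔-∘ t≈u v)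

module StrictPartialOrderPaths {a : Level} (hmp : HausdorffMaximalPrinciple a)
  {A : Set a} {_<_ : Rel A a} (isSPO : IsStrictPartialOrder _≡_ _<_) where

  open PathProperties _<_

  path-through-comparable : ∀ {t v} → Comparable _<_ t v →
                            ∃ λ (P : Pred A a) → IsPath _<_ P × t ∈ P × v ∈ P
  path-through-comparable {t} {v} t~v
    with hmp A _<_ isSPO (λ y → y ≡ t ⊎ y ≡ v) linear
    where
    linear : Linear _<_ λ y → y ≡ t ⊎ y ≡ v
    linear _ _ (inj₁ refl) (inj₁ refl) = comparable-refl
    linear _ _ (inj₁ refl) (inj₂ refl) = t~v
    linear _ _ (inj₂ refl) (inj₁ refl) = comparable-sym t~v
    linear _ _ (inj₂ refl) (inj₂ refl) = comparable-refl
  ... | P , pathP , tv⊆P = P , pathP , tv⊆P (inj₁ refl) , tv⊆P (inj₂ refl)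

  samePaths⇒sameComparables : ∀ {t u} → SamePaths _<_ t u → SameComparables _<_ t u
  samePaths⇒sameComparables {t} {u} t≈u v =
    mk⇔ (transport t≈u) (transport λ P pathP → ⇔-sym (t≈u P pathP))
    where
    transport : ∀ {x y} → SamePaths _<_ x y → Comparable _<_ v x → Comparable _<_ v y
    transport {x} {y} x≈y v~x with path-through-comparable v~x
    ... | P , pathP , v∈P , x∈P = proj₁ pathP v y v∈P (to (x≈y P pathP) x∈P)

  bridge⊆sameComparables : ∀ {B : Pred A a} → IsBridge _<_ B →
                           ∀ {t} → t ∈ B → B ⊆ SameComparables _<_ t
  bridge⊆sameComparables bridgeB t∈B u∈B =
    samePaths⇒sameComparables (bridge⇒samePaths bridgeB t∈B u∈B)

  inCommonBridge⇒sameComparables : ∀ {t u} → InCommonBridge _<_ t u → SameComparables _<_ t u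
  inCommonBridge⇒sameComparables = samePaths⇒sameComparables ∘ inCommonBridge⇒samePaths

module ForestBridges {a : Level} (em : ExcludedMiddle a) (hmp : HausdorffMaximalPrinciple a)
  {A : Set a} {_<_ : Rel A a} (isSPO : IsStrictPartialOrder _≡_ _<_)
  (predecessorsLinear : ∀ x y z → y < x → z < x → Comparable _<_ y z) where

  open PathProperties _<_
  open StrictPartialOrderPaths hmp isSPO

  path-downClosed : ∀ {P : Pred A a} → IsPath _<_ P → ∀ {x z} → z ∈ P → x < z → x ∈ P
  path-downClosed {P} pathP {x} {z} z∈P x<z = comparableWithAll⇒∈path pathP x x~P
    where
    x~P : ∀ w → w ∈ P → Comparable _<_ x w
    x~P w w∈P with proj₁ pathP z w z∈P w∈P
    ... | inj₁ z<w         = inj₁ (IsStrictPartialOrder.trans isSPO x<z z<w)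
    ... | inj₂ (inj₁ refl) = inj₁ x<z
    ... | inj₂ (inj₂ w<z)  = predecessorsLinear z x w x<z w<z

  sameComparables-isBridge : ∀ t → IsBridge _<_ (SameComparables _<_ t)
  sameComparables-isBridge t =
    (t , sameComparables-refl) , (convex , linear) , allOrNothing
    where
    C : Pred A a
    C = SameComparables _<_ t

    convex : Convex _<_ C
    convex x y z t≈x t≈y x<z z<y = samePaths⇒sameComparables λ P pathP → mk⇔
      (λ t∈P → path-downClosed pathP (to (sameComparables⇒samePaths t≈y P pathP) t∈P) z<y)
      (λ z∈P → from (sameComparables⇒samePaths t≈x P pathP) (path-downClosed pathP z∈P x<z))

    linear : Linear _<_ C
    linear x y t≈x t≈y with path-through-comparable (comparable-refl {x = t})
    ... | P , pathP , t∈P , _ = proj₁ pathP x y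
      (to (sameComparables⇒samePaths t≈x P pathP) t∈P)
      (to (sameComparables⇒samePaths t≈y P pathP) t∈P)

    allOrNothing : ∀ (P : Pred A a) → IsPath _<_ P →
                   (C ⊆ P) ⊎ (∀ x → x ∈ C → x ∈ P → ⊥)
    allOrNothing P pathP with em {t ∈ P}
    ... | yes t∈P = inj₁ λ t≈x → to (sameComparables⇒samePaths t≈x P pathP) t∈P
    ... | no  t∉P =
      inj₂ λ x t≈x x∈P → t∉P (from (sameComparables⇒samePaths t≈x P pathP) x∈P)

  sameComparables-isBridgeClassOf : ∀ t → IsBridgeClassOf _<_ t (SameComparables _<_ t)
  sameComparables-isBridgeClassOf t =
    ( sameComparables-isBridge t
    , λ B bridgeB C⊆B → bridge⊆sameComparables bridgeB (C⊆B sameComparables-refl))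
    , sameComparables-refl

  bridgeClass≐sameComparables : ∀ {t M} → IsBridgeClassOf _<_ t M → M ≐ SameComparables _<_ t
  bridgeClass≐sameComparables {t} {M} ((bridgeM , maximalM) , t∈M) =
    M⊆C , maximalM (SameComparables _<_ t) (sameComparables-isBridge t) M⊆C
    where
    M⊆C : M ⊆ SameComparables _<_ t
    M⊆C = bridge⊆sameComparables bridgeM t∈M

  sameComparables⇒inCommonBridge : ∀ {t u} → SameComparables _<_ t u → InCommonBridge _<_ t u
  sameComparables⇒inCommonBridge {t} t≈u =
    SameComparables _<_ t , sameComparables-isBridge t , sameComparables-refl , t≈u

  sameComparables⇒sameBridgeClass : ∀ {t u} → SameComparables _<_ t u → SameBridgeClass _<_ t u
  sameComparables⇒sameBridgeClass t≈u M N [t]≐M [u]≐N =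
    ≐-trans (bridgeClass≐sameComparables [t]≐M)
      (≐-trans (sameComparables⇒≐ t≈u) (≐-sym (bridgeClass≐sameComparables [u]≐N)))

  sameBridgeClass⇒sameComparables : ∀ {t u} → SameBridgeClass _<_ t u → SameComparables _<_ t u
  sameBridgeClass⇒sameComparables {t} {u} [t]≐[u] =
    proj₂ ([t]≐[u] _ _ (sameComparables-isBridgeClassOf t) (sameComparables-isBridgeClassOf u))
      sameComparables-refl

proposition4p5 : (lem : ∀ {p : Level} → ExcludedMiddle p) →
    ∀ {ℓ : Level} → HausdorffMaximalPrinciple ℓ → (𝔗 : Tree ℓ) →
    let open Tree 𝔗 renaming (Carrier to T) in
    ∀ (t u : T) →
      ((∃ λ (B : Pred T ℓ) → IsBridge _<_ B × t ∈ B × u ∈ B)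
        ⇔ (∀ (M N : Pred T ℓ) → IsBridgeClassOf _<_ t M → IsBridgeClassOf _<_ u N → M ≐ N))
      × ((∃ λ (B : Pred T ℓ) → IsBridge _<_ B × t ∈ B × u ∈ B)
        ⇔ (∀ (P : Pred T ℓ) → IsPath _<_ P → (t ∈ P ⇔ u ∈ P)))
      × ((∃ λ (B : Pred T ℓ) → IsBridge _<_ B × t ∈ B × u ∈ B)
        ⇔ (∀ (v : T) → Comparable _<_ v t ⇔ Comparable _<_ v u))
proposition4p5 lem hmp 𝔗 t u =
    mk⇔ (sameComparables⇒sameBridgeClass ∘ inCommonBridge⇒sameComparables)
        (sameComparables⇒inCommonBridge ∘ sameBridgeClass⇒sameComparables)
  , mk⇔ inCommonBridge⇒samePaths (sameComparables⇒inCommonBridge ∘ samePaths⇒sameComparables)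
  , mk⇔ inCommonBridge⇒sameComparables sameComparables⇒inCommonBridge
  where
  open Tree 𝔗
  open PathProperties _<_
  open StrictPartialOrderPaths hmp isStrictPartialOrder
  open ForestBridges lem hmp isStrictPartialOrder predecessorsLinear
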